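{- Let $d\ge 2$ be a constant, let $\mathcal{H}$ be a $d$-uniform hypergraph with vertex set $U(\mathcal{H})$, let $k$ be a positive integer, and let $\gamma=100d^2$. Choose a random hash function $h:U(\mathcal{H})\to[\gamma k^2]$ (each vertex receives a color uniformly and independently at random), and let $U_i=\{u\in U(\mathcal{H}): h(u)=i\}$. For every $1\le i_1<\dots<i_d\le \gamma k^2$ with all $U_{i_j}$ non-empty, make a GPISE query on $(U_{i_1},\dots,U_{i_d})$, and let $\hat{\mathcal{H}}$ be the hypergraph with $U(\hat{\mathcal{H}})=U(\mathcal{H})$ whose hyperedges are exactly the hyperedges returned by these queries. If $\mathcal{H}$ has a packing (a set of pairwise vertex-disjoint hyperedges) of size at least $k$, then with probability at least $2/3$ the hypergraph $\hat{\mathcal{H}}$ has a packing of size at least $k$.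
   Context: The GPISE oracle for $\mathcal{H}$ takes $d$ pairwise disjoint non-empty subsets $A_1,\dots,A_d\subseteq U(\mathcal{H})$ and returns some hyperedge of $\mathcal{H}$ having one vertex in each $A_i$ (an arbitrary such hyperedge) if one exists, and NULL otherwise; the probability is over the choice of $h$ and holds whatever valid answers the oracle gives. -}

module Defs where

open import Data.Nat using (ℕ; _*_; _≥_; _^_)
open import Data.Fin using (Fin) renaming (_<_ to _<ᶠ_)
open import Data.Fin.Subset using (Subset; ∣_∣; _∩_; Empty) renaming (_∈_ to _∈ˢ_)
open import Data.Vec using (Vec; lookup)
open import Data.List using (List; length)
open import Data.List.Membership.Propositional using (_∈_)
open import Data.List.Relation.Unary.All using (All)
open import Data.List.Relation.Unary.AllPairs using (AllPairs)
open import Data.List.Relation.Unary.Unique.Propositional using (Unique)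
open import Data.Maybe using (Maybe; just; nothing)
open import Data.Product using (Σ; ∃; _×_)
open import Relation.Binary.PropositionalEquality using (_≡_)
open import Relation.Nullary using (¬_)

Hypergraph : ℕ → Set
Hypergraph n = List (Subset n)

Uniform : ∀ {n} → ℕ → Hypergraph n → Set
Uniform d H = All (λ e → ∣ e ∣ ≡ d) H

HasPackingP : ∀ {n} → (Subset n → Set) → ℕ → Set
HasPackingP {n} E k =
  Σ (List (Subset n)) λ P → All E P × AllPairs (λ a b → Empty (a ∩ b)) P × length P ≥ k

HasPacking : ∀ {n} → Hypergraph n → ℕ → Set
HasPacking H k = HasPackingP (λ e → e ∈ H) k

-- Hash function h : Fin n → Fin m, represented as a vector (so the finite
-- sample space of all m^n hash functions has decidable equality).
Hash : ℕ → ℕ → Set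
Hash n m = Vec (Fin m) n

ValidQuery : ∀ {n m d} → Hash n m → Vec (Fin m) d → Set
ValidQuery {n} {m} {d} h t =
  (∀ (j j' : Fin d) → j <ᶠ j' → lookup t j <ᶠ lookup t j')
  × (∀ (j : Fin d) → ∃ λ (u : Fin n) → lookup h u ≡ lookup t j)

Fits : ∀ {n m d} → Hash n m → Vec (Fin m) d → Subset n → Set
Fits {n} {m} {d} h t e = ∀ (j : Fin d) → ∃ λ (u : Fin n) → u ∈ˢ e × lookup h u ≡ lookup t j

Answers : ℕ → ℕ → ℕ → Set
Answers n m d = Vec (Fin m) d → Maybe (Subset n)

ValidAnswers : ∀ {n m d} → Hypergraph n → Hash n m → Answers n m d → Set
ValidAnswers H h ans = ∀ t → ValidQuery h t →
    (ans t ≡ nothing → ¬ (∃ λ e → e ∈ H × Fits h t e))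
  × (∀ e → ans t ≡ just e → e ∈ H × Fits h t e)

HatEdge : ∀ {n m d} → Hash n m → Answers n m d → Subset n → Set
HatEdge h ans e = ∃ λ t → ValidQuery h t × ans t ≡ just e

Good : ∀ {n m} → ℕ → Hypergraph n → ℕ → Hash n m → Set
Good {n} {m} d H k h =
  (ans : Answers n m d) → ValidAnswers H h ans → HasPackingP (HatEdge h ans) k

-- Pr_h[P] ≥ 2/3 under uniform h : Fin n → Fin m : at least 2/3 of the m^n
-- hash functions satisfy P, witnessed by a duplicate-free list of them.
ProbAtLeastTwoThirds : ∀ n m → (Hash n m → Set) → Set
ProbAtLeastTwoThirds n m P =
  Σ (List (Hash n m)) λ L → Unique L × All P L × 3 * length L ≥ 2 * (m ^ n)

gamma : ℕ → ℕ
gamma d = 100 * (d * d)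

module Submission where

-- Let P be a packing of k edges of the d-uniform hypergraph H and S its vertex
-- set, so ∣ S ∣ ≤ d k.  The proof has two independent halves.
--
-- (1) Combinatorics of one hash function.  If h is injective on S, then for each
--     edge e of P the d colours of e, sorted, form a valid query which e fits; the
--     oracle must therefore answer with some edge q, and since q is d-uniform and
--     meets all d colour classes of e, q uses only colours of e.  Answer edges
--     coming from different edges of P thus use disjoint colour sets, hence are
--     vertex-disjoint, and Ĥ has a packing of size k (transfer-packing).
-- (2) Counting.  The hash functions injective on S are enumerated vertex by vertex
--     (injectiveHashes); a vertex of S has at least m ∸ ∣ S ∣ admissible colours,
--     which yields the collision bound  m·mⁿ ≤ m·N + ∣ S ∣²·mⁿ  for their number N.
--     With m = 100 d² k² ≥ 3 (d k)² this gives N ≥ (2/3)·mⁿ (two-thirds).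

open import Defs
open import Data.Nat using (ℕ; zero; suc; _+_; _*_; _∸_; _^_; _≤_; _<_; _≥_; z≤n; s≤s; >-nonZero)
open import Data.Nat.Properties
open import Data.Nat.Tactic.RingSolver using (solve-∀)
open import Data.Fin using (Fin; zero; suc) renaming (_<_ to _<ᶠ_)
import Data.Fin.Properties as Finₚ
open import Data.Fin.Subset
  using (Subset; Side; inside; outside; ∣_∣; _∩_; _∪_; ⋃; ⊤; ⁅_⁆; ∁; Empty)
  renaming (_∈_ to _∈ˢ_; _⊆_ to _⊆ˢ_)
open import Data.Fin.Subset.Properties
  using (∣⊤∣≡n; ∣⊥∣≡0; ∣⁅x⁆∣≡1; x∈⁅x⁆; x∈⁅y⁆⇒x≡y; ∣p∣≤∣x∷p∣; x∈∁p⇒x∉p; ∣∁p∣≡n∸∣p∣;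
         p⊆p∪q; q⊆p∪q; x∈p∪q⁻; x∈p∩q⁺; x∈p∩q⁻; ∉⊥)
open import Data.Vec.Base using (Vec; []; _∷_; lookup; here; there)
import Data.Vec.Properties as Vecₚ
open import Data.List using (List; []; _∷_; _++_; length; map; tabulate; take)
open import Data.List.Properties using (length-map; length-++; length-removeAt′; length-tabulate; length-take)
open import Data.List.Membership.Propositional using (_∈_; _─_)
open import Data.List.Membership.Propositional.Properties using (∈-map⁺; ∈-map⁻; ∈-++⁻; ∈-tabulate⁻)
open import Data.List.Relation.Unary.Any using (here; there; index)
open import Data.List.Relation.Unary.All as All using (All; []; _∷_)
import Data.List.Relation.Unary.All.Properties as Allₚ
open import Data.List.Relation.Unary.AllPairs as AllPairs using (AllPairs; []; _∷_)
import Data.List.Relation.Unary.AllPairs.Properties as AllPairsₚ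
open import Data.List.Relation.Unary.Unique.Propositional using (Unique)
import Data.List.Relation.Unary.Unique.Propositional.Properties as Uniqueₚ
open import Data.List.Relation.Binary.Subset.Propositional using (_⊆_)
open import Data.Product using (Σ; ∃; _×_; _,_; proj₁; proj₂)
open import Data.Sum using (inj₁; inj₂)
open import Data.Empty using (⊥-elim)
open import Relation.Binary.PropositionalEquality
open import Relation.Binary.Definitions using (tri<; tri≈; tri>)
open import Data.Maybe using (just; nothing)
open import Relation.Nullary using (¬_; yes; no)

module _ {A : Set} where

  ∈-─ : ∀ {x z : A} (ys : List A) (p : x ∈ ys) → z ∈ ys → z ≢ x → z ∈ ys ─ p
  ∈-─ (y ∷ ys) (here x≡y) (here z≡y) z≢x = ⊥-elim (z≢x (trans z≡y (sym x≡y)))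
  ∈-─ (y ∷ ys) (here _)   (there z∈) z≢x = z∈
  ∈-─ (y ∷ ys) (there p)  (here z≡y) z≢x = here z≡y
  ∈-─ (y ∷ ys) (there p)  (there z∈) z≢x = there (∈-─ ys p z∈ z≢x)

  unique-length-≤ : ∀ {xs ys : List A} → Unique xs → xs ⊆ ys → length xs ≤ length ys
  unique-length-≤ {[]}     _              _   = z≤n
  unique-length-≤ {x ∷ xs} {ys} (x∉xs ∷ xs!) xs⊆ys = begin
    suc (length xs)            ≤⟨ s≤s (unique-length-≤ xs! xs⊆ys─x) ⟩
    suc (length (ys ─ x∈ys))   ≡⟨ sym (length-removeAt′ ys (index x∈ys)) ⟩
    length ys                  ∎
    where
    open ≤-Reasoning
    x∈ys : x ∈ ys
    x∈ys = xs⊆ys (here refl)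
    xs⊆ys─x : xs ⊆ ys ─ x∈ys
    xs⊆ys─x z∈xs = ∈-─ ys x∈ys (xs⊆ys (there z∈xs)) (λ z≡x → All.lookup x∉xs z∈xs (sym z≡x))

  map-unique : ∀ {B : Set} (f : A → B) {xs : List A} → Unique xs →
    (∀ {x y} → x ∈ xs → y ∈ xs → f x ≡ f y → x ≡ y) → Unique (map f xs)
  map-unique f {[]}     []           _   = []
  map-unique f {x ∷ xs} (x∉xs ∷ xs!) inj =
    Allₚ.map⁺ (All.tabulate (λ y∈xs fx≡fy → All.lookup x∉xs y∈xs (inj (here refl) (there y∈xs) fx≡fy)))
    ∷ map-unique f xs! (λ x∈ y∈ → inj (there x∈) (there y∈))

elements : ∀ {n} → Subset n → List (Fin n)
elements {zero}  []            = []
elements {suc n} (outside ∷ p) = map suc (elements p)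
elements {suc n} (inside ∷ p)  = zero ∷ map suc (elements p)

elements-length : ∀ {n} → (p : Subset n) → length (elements p) ≡ ∣ p ∣
elements-length []            = refl
elements-length (outside ∷ p) = trans (length-map suc (elements p)) (elements-length p)
elements-length (inside ∷ p)  = cong suc (trans (length-map suc (elements p)) (elements-length p))

elements⁺ : ∀ {n} {x} (p : Subset n) → x ∈ˢ p → x ∈ elements p
elements⁺ (inside ∷ p)  here     = here refl
elements⁺ (outside ∷ p) (there x∈p) = ∈-map⁺ suc (elements⁺ p x∈p)
elements⁺ (inside ∷ p)  (there x∈p) = there (∈-map⁺ suc (elements⁺ p x∈p))

elements⁻ : ∀ {n} {x} (p : Subset n) → x ∈ elements p → x ∈ˢ p
elements⁻ (outside ∷ p) x∈ with ∈-map⁻ suc x∈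
... | y , y∈ , refl = there (elements⁻ p y∈)
elements⁻ (inside ∷ p) (here refl) = here
elements⁻ (inside ∷ p) (there x∈) with ∈-map⁻ suc x∈
... | y , y∈ , refl = there (elements⁻ p y∈)

elements-increasing : ∀ {n} → (p : Subset n) → AllPairs _<ᶠ_ (elements p)
elements-increasing []            = []
elements-increasing (outside ∷ p) = AllPairsₚ.map⁺ (AllPairs.map s≤s (elements-increasing p))
elements-increasing (inside ∷ p)  =
  Allₚ.map⁺ (All.universal (λ _ → s≤s z≤n) (elements p))
  ∷ AllPairsₚ.map⁺ (AllPairs.map s≤s (elements-increasing p))

elements-unique : ∀ {n} → (p : Subset n) → Unique (elements p)
elements-unique p = AllPairs.map Finₚ.<⇒≢ (elements-increasing p)

unique-⊆-size : ∀ {n} {xs : List (Fin n)} (p : Subset n) → Unique xs → All (_∈ˢ p) xs → length xs ≤ ∣ p ∣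
unique-⊆-size {xs = xs} p xs! xs⊆p = subst (length xs ≤_) (elements-length p)
  (unique-length-≤ xs! (λ x∈xs → elements⁺ p (All.lookup xs⊆p x∈xs)))

∣p∪q∣≤∣p∣+∣q∣ : ∀ {n} → (p q : Subset n) → ∣ p ∪ q ∣ ≤ ∣ p ∣ + ∣ q ∣
∣p∪q∣≤∣p∣+∣q∣ []            []            = z≤n
∣p∪q∣≤∣p∣+∣q∣ (outside ∷ p) (outside ∷ q) = ∣p∪q∣≤∣p∣+∣q∣ p q
∣p∪q∣≤∣p∣+∣q∣ (outside ∷ p) (inside ∷ q)  =
  ≤-trans (s≤s (∣p∪q∣≤∣p∣+∣q∣ p q)) (≤-reflexive (sym (+-suc ∣ p ∣ ∣ q ∣)))
∣p∪q∣≤∣p∣+∣q∣ (inside ∷ p)  (s ∷ q)       =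
  s≤s (≤-trans (∣p∪q∣≤∣p∣+∣q∣ p q) (+-monoʳ-≤ ∣ p ∣ (∣p∣≤∣x∷p∣ s q)))

∣⋃∣≤ : ∀ {n} c (ps : List (Subset n)) → All (λ p → ∣ p ∣ ≤ c) ps → ∣ ⋃ ps ∣ ≤ c * length ps
∣⋃∣≤ {n} c []       []            = subst (_≤ c * 0) (sym (∣⊥∣≡0 n)) z≤n
∣⋃∣≤ c (p ∷ ps) (∣p∣≤c ∷ ps≤) = begin
  ∣ p ∪ ⋃ ps ∣          ≤⟨ ∣p∪q∣≤∣p∣+∣q∣ p (⋃ ps) ⟩
  ∣ p ∣ + ∣ ⋃ ps ∣      ≤⟨ +-mono-≤ ∣p∣≤c (∣⋃∣≤ c ps ps≤) ⟩
  c + c * length ps     ≡⟨ sym (*-suc c (length ps)) ⟩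
  c * suc (length ps)   ∎
  where open ≤-Reasoning

∈⋃⁺ : ∀ {n} {x p} {ps : List (Subset n)} → p ∈ ps → x ∈ˢ p → x ∈ˢ ⋃ ps
∈⋃⁺ {ps = q ∷ ps} (here refl) x∈p = p⊆p∪q (⋃ ps) x∈p
∈⋃⁺ {ps = q ∷ ps} (there p∈)  x∈p = q⊆p∪q q (⋃ ps) (∈⋃⁺ p∈ x∈p)

∈⋃⁻ : ∀ {n} {x} (ps : List (Subset n)) → x ∈ˢ ⋃ ps → ∃ λ p → p ∈ ps × x ∈ˢ p
∈⋃⁻ []       x∈ = ⊥-elim (∉⊥ x∈)
∈⋃⁻ (p ∷ ps) x∈ with x∈p∪q⁻ p (⋃ ps) x∈
... | inj₁ x∈p  = p , here refl , x∈p
... | inj₂ x∈ps with ∈⋃⁻ ps x∈ps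
...   | q , q∈ , x∈q = q , there q∈ , x∈q

InjectiveOn : ∀ {n m} → Hash n m → Subset n → Set
InjectiveOn h S = ∀ {u v} → u ∈ˢ S → v ∈ˢ S → lookup h u ≡ lookup h v → u ≡ v

colours : ∀ {n m} → Hash n m → Subset n → Subset m
colours h S = ⋃ (map (λ u → ⁅ lookup h u ⁆) (elements S))

colours⁺ : ∀ {n m} (h : Hash n m) {S : Subset n} {u} → u ∈ˢ S → lookup h u ∈ˢ colours h S
colours⁺ h {S} u∈S = ∈⋃⁺ (∈-map⁺ _ (elements⁺ S u∈S)) (x∈⁅x⁆ _)

colours⁻ : ∀ {n m} (h : Hash n m) (S : Subset n) {c} → c ∈ˢ colours h S →
  ∃ λ u → u ∈ˢ S × lookup h u ≡ c
colours⁻ h S c∈ with ∈⋃⁻ (map (λ u → ⁅ lookup h u ⁆) (elements S)) c∈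
... | p , p∈ , c∈p with ∈-map⁻ (λ u → ⁅ lookup h u ⁆) p∈
...   | u , u∈ , refl = u , elements⁻ S u∈ , sym (x∈⁅y⁆⇒x≡y _ c∈p)

injectiveOn-⊆ : ∀ {n m} (h : Hash n m) {S T : Subset n} → T ⊆ˢ S → InjectiveOn h S → InjectiveOn h T
injectiveOn-⊆ h T⊆S inj u∈T v∈T = inj (T⊆S u∈T) (T⊆S v∈T)

colours-mono : ∀ {n m} (h : Hash n m) {S T : Subset n} → S ⊆ˢ T → colours h S ⊆ˢ colours h T
colours-mono h {S} S⊆T c∈ with colours⁻ h S c∈
... | u , u∈S , refl = colours⁺ h (S⊆T u∈S)

colours-size : ∀ {n m} (h : Hash n m) (S : Subset n) → ∣ colours h S ∣ ≤ ∣ S ∣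
colours-size {m = m} h S = begin
  ∣ colours h S ∣                          ≤⟨ ∣⋃∣≤ 1 singletons (Allₚ.map⁺ (All.universal singleton-size (elements S))) ⟩
  1 * length singletons                    ≡⟨ *-identityˡ _ ⟩
  length singletons                        ≡⟨ length-map _ (elements S) ⟩
  length (elements S)                      ≡⟨ elements-length S ⟩
  ∣ S ∣                                    ∎
  where
  open ≤-Reasoning
  singletons : List (Subset m)
  singletons = map (λ u → ⁅ lookup h u ⁆) (elements S)
  singleton-size : ∀ u → ∣ ⁅ lookup h u ⁆ ∣ ≤ 1
  singleton-size u = ≤-reflexive (∣⁅x⁆∣≡1 (lookup h u))

colours-size-injective : ∀ {n m} (h : Hash n m) (S : Subset n) → InjectiveOn h S →
  ∣ colours h S ∣ ≡ ∣ S ∣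
colours-size-injective h S inj = ≤-antisym (colours-size h S) (begin
  ∣ S ∣                                 ≡⟨ sym (elements-length S) ⟩
  length (elements S)                   ≡⟨ sym (length-map (lookup h) (elements S)) ⟩
  length (map (lookup h) (elements S))  ≤⟨ unique-⊆-size (colours h S) distinct inColours ⟩
  ∣ colours h S ∣                       ∎)
  where
  open ≤-Reasoning
  distinct : Unique (map (lookup h) (elements S))
  distinct = map-unique (lookup h) (elements-unique S)
    (λ u∈ v∈ → inj (elements⁻ S u∈) (elements⁻ S v∈))
  inColours : All (_∈ˢ colours h S) (map (lookup h) (elements S))
  inColours = Allₚ.map⁺ (All.tabulate (λ u∈ → colours⁺ h (elements⁻ S u∈)))

module _ {A : Set} where

  extensions : ∀ {n} → (Vec A n → List A) → List (Vec A n) → List (Vec A (suc n))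
  extensions f []       = []
  extensions f (h ∷ hs) = map (_∷ h) (f h) ++ extensions f hs

  extensions-tail : ∀ {n} (f : Vec A n → List A) (hs : List (Vec A n)) {c h} →
    (c ∷ h) ∈ extensions f hs → h ∈ hs
  extensions-tail f (h′ ∷ hs) c∷h∈ with ∈-++⁻ (map (_∷ h′) (f h′)) c∷h∈
  ... | inj₁ c∷h∈heads with ∈-map⁻ (_∷ h′) c∷h∈heads
  ...   | _ , _ , refl = here refl
  extensions-tail f (h′ ∷ hs) c∷h∈ | inj₂ c∷h∈rest = there (extensions-tail f hs c∷h∈rest)

  extensions-unique : ∀ {n} (f : Vec A n → List A) {hs : List (Vec A n)} →
    (∀ h → Unique (f h)) → Unique hs → Unique (extensions f hs)
  extensions-unique f {[]}     f! []           = []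
  extensions-unique f {h ∷ hs} f! (h∉hs ∷ hs!) =
    Uniqueₚ.++⁺ (Uniqueₚ.map⁺ Vecₚ.∷-injectiveˡ (f! h))
                (extensions-unique f f! hs!)
                disjoint
    where
    disjoint : ∀ {v} → ¬ (v ∈ map (_∷ h) (f h) × v ∈ extensions f hs)
    disjoint (v∈heads , v∈rest) with ∈-map⁻ (_∷ h) v∈heads
    ... | _ , _ , refl = All.lookup h∉hs (extensions-tail f hs v∈rest) refl

  extensions-all : ∀ {n} {Q : Vec A n → Set} {P : Vec A (suc n) → Set} (f : Vec A n → List A)
    {hs : List (Vec A n)} → All Q hs → (∀ {h} → Q h → ∀ {c} → c ∈ f h → P (c ∷ h)) →
    All P (extensions f hs)
  extensions-all f []         step = []
  extensions-all f (qh ∷ qhs) step =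
    Allₚ.++⁺ (Allₚ.map⁺ (All.tabulate (step qh))) (extensions-all f qhs step)

  extensions-length : ∀ {n} (f : Vec A n → List A) (h : Vec A n) (hs : List (Vec A n)) →
    length (extensions f (h ∷ hs)) ≡ length (f h) + length (extensions f hs)
  extensions-length f h hs =
    trans (length-++ (map (_∷ h) (f h))) (cong (_+ _) (length-map (_∷ h) (f h)))

  extensions-length-≥ : ∀ {n} (f : Vec A n → List A) lo (hs : List (Vec A n)) →
    (∀ h → lo ≤ length (f h)) → lo * length hs ≤ length (extensions f hs)
  extensions-length-≥ f lo []       _  = ≤-reflexive (*-zeroʳ lo)
  extensions-length-≥ f lo (h ∷ hs) lo≤ = begin
    lo * suc (length hs)                      ≡⟨ *-suc lo (length hs) ⟩
    lo + lo * length hs                       ≤⟨ +-mono-≤ (lo≤ h) (extensions-length-≥ f lo hs lo≤) ⟩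
    length (f h) + length (extensions f hs)   ≡⟨ sym (extensions-length f h hs) ⟩
    length (extensions f (h ∷ hs))            ∎
    where open ≤-Reasoning

  extensions-length-≤ : ∀ {n} (f : Vec A n → List A) hi (hs : List (Vec A n)) →
    (∀ h → length (f h) ≤ hi) → length (extensions f hs) ≤ hi * length hs
  extensions-length-≤ f hi []       _   = z≤n
  extensions-length-≤ f hi (h ∷ hs) ≤hi = begin
    length (extensions f (h ∷ hs))            ≡⟨ extensions-length f h hs ⟩
    length (f h) + length (extensions f hs)   ≤⟨ +-mono-≤ (≤hi h) (extensions-length-≤ f hi hs ≤hi) ⟩
    hi + hi * length hs                       ≡⟨ sym (*-suc hi (length hs)) ⟩
    hi * suc (length hs)                      ∎
    where open ≤-Reasoning

scale-bound : ∀ m M a N N′ t → m * M ≤ a * N + t * M → a * N ≤ N′ →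
  m * (m * M) ≤ m * N′ + t * (m * M)
scale-bound m M a N N′ t bound aN≤N′ = begin
  m * (m * M)                  ≤⟨ *-monoʳ-≤ m bound ⟩
  m * (a * N + t * M)          ≡⟨ regroup m a N t M ⟩
  m * (a * N) + t * (m * M)    ≤⟨ +-monoˡ-≤ _ (*-monoʳ-≤ m aN≤N′) ⟩
  m * N′ + t * (m * M)         ∎
  where
  open ≤-Reasoning
  regroup : ∀ m a N t M → m * (a * N + t * M) ≡ m * (a * N) + t * (m * M)
  regroup = solve-∀

-- Passing from s to s + 1: if m·M ≤ m·N + s²·M and N ≤ M, the bound survives
-- with only m ∸ s choices per element of N, because the s·N ≤ s·M lost choices
-- are absorbed by the increase from s² to (s + 1)².
fresh-choice-bound : ∀ m M N s → m * M ≤ m * N + s * s * M → N ≤ M →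
  m * M ≤ (m ∸ s) * N + suc s * suc s * M
fresh-choice-bound m M N s bound N≤M = begin
  m * M                                        ≤⟨ bound ⟩
  m * N + s * s * M                            ≤⟨ +-monoˡ-≤ _ (*-monoˡ-≤ N (m≤n+m∸n m s)) ⟩
  (s + (m ∸ s)) * N + s * s * M                ≡⟨ split s (m ∸ s) N M ⟩
  (m ∸ s) * N + (s * N + s * s * M)            ≤⟨ +-monoʳ-≤ ((m ∸ s) * N) (+-monoˡ-≤ _ (*-monoʳ-≤ s N≤M)) ⟩
  (m ∸ s) * N + (s * M + s * s * M)            ≤⟨ +-monoʳ-≤ ((m ∸ s) * N) (m≤m+n _ (M + s * M)) ⟩
  (m ∸ s) * N + (s * M + s * s * M + (M + s * M)) ≡⟨ cong ((m ∸ s) * N +_) (square s M) ⟩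
  (m ∸ s) * N + suc s * suc s * M              ∎
  where
  open ≤-Reasoning
  split : ∀ s r N M → (s + r) * N + s * s * M ≡ r * N + (s * N + s * s * M)
  split = solve-∀
  square : ∀ s M → s * M + s * s * M + (M + s * M) ≡ suc s * suc s * M
  square = solve-∀

two-thirds : ∀ m M N s D → m * M ≤ m * N + s * s * M → s ≤ D → 3 * (D * D) ≤ m → 0 < m →
  2 * M ≤ 3 * N
two-thirds m M N s D bound s≤D 3D²≤m m>0 =
  *-cancelˡ-≤ m {{>-nonZero m>0}} (+-cancelʳ-≤ (m * M) _ _ (begin
    m * (2 * M) + m * M          ≡⟨ triple m M ⟩
    3 * (m * M)                  ≤⟨ *-monoʳ-≤ 3 bound ⟩
    3 * (m * N + s * s * M)      ≡⟨ distribute m N s M ⟩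
    m * (3 * N) + 3 * (s * s) * M  ≤⟨ +-monoʳ-≤ (m * (3 * N)) (*-monoˡ-≤ M 3s²≤m) ⟩
    m * (3 * N) + m * M          ∎))
  where
  open ≤-Reasoning
  3s²≤m : 3 * (s * s) ≤ m
  3s²≤m = ≤-trans (*-monoʳ-≤ 3 (*-mono-≤ s≤D s≤D)) 3D²≤m
  triple : ∀ m M → m * (2 * M) + m * M ≡ 3 * (m * M)
  triple = solve-∀
  distribute : ∀ m N s M → 3 * (m * N + s * s * M) ≡ m * (3 * N) + 3 * (s * s) * M
  distribute = solve-∀

module InjectiveHashes (m : ℕ) where

  allowed : ∀ {n} → Side → Subset n → Hash n m → Subset m
  allowed outside S h = ⊤
  allowed inside  S h = ∁ (colours h S)

  injectiveHashes : ∀ {n} → Subset n → List (Hash n m)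
  injectiveHashes []      = [] ∷ []
  injectiveHashes (s ∷ S) = extensions (λ h → elements (allowed s S h)) (injectiveHashes S)

  injectiveHashes-unique : ∀ {n} (S : Subset n) → Unique (injectiveHashes S)
  injectiveHashes-unique []      = [] ∷ []
  injectiveHashes-unique (s ∷ S) =
    extensions-unique _ (λ h → elements-unique (allowed s S h)) (injectiveHashes-unique S)

  extend-injective : ∀ {n} {h : Hash n m} {S : Subset n} s {c} →
    InjectiveOn h S → c ∈ˢ allowed s S h → InjectiveOn (c ∷ h) (s ∷ S)
  extend-injective s      inj c∈ here        here        _     = refl
  extend-injective {h = h} {S} inside inj c∈ here (there v∈S) c≡hv  =
    ⊥-elim (x∈∁p⇒x∉p c∈ (subst (_∈ˢ colours h S) (sym c≡hv) (colours⁺ h v∈S)))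
  extend-injective {h = h} {S} inside inj c∈ (there u∈S) here hu≡c  =
    ⊥-elim (x∈∁p⇒x∉p c∈ (subst (_∈ˢ colours h S) hu≡c (colours⁺ h u∈S)))
  extend-injective s      inj c∈ (there u∈S) (there v∈S) hu≡hv = cong suc (inj u∈S v∈S hu≡hv)

  injectiveHashes-injective : ∀ {n} (S : Subset n) → All (λ h → InjectiveOn h S) (injectiveHashes S)
  injectiveHashes-injective []      = (λ ()) ∷ []
  injectiveHashes-injective (s ∷ S) =
    extensions-all _ (injectiveHashes-injective S)
      (λ inj c∈ → extend-injective s inj (elements⁻ (allowed s S _) c∈))

  allowed-≤ : ∀ {n} s (S : Subset n) (h : Hash n m) → length (elements (allowed s S h)) ≤ m
  allowed-≤ outside S h = ≤-reflexive (trans (elements-length (⊤ {m})) (∣⊤∣≡n m))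
  allowed-≤ inside  S h = begin
    length (elements (∁ (colours h S)))  ≡⟨ elements-length (∁ (colours h S)) ⟩
    ∣ ∁ (colours h S) ∣                  ≡⟨ ∣∁p∣≡n∸∣p∣ (colours h S) ⟩
    m ∸ ∣ colours h S ∣                  ≤⟨ m∸n≤m m ∣ colours h S ∣ ⟩
    m                                    ∎
    where open ≤-Reasoning

  allowed-inside-≥ : ∀ {n} (S : Subset n) (h : Hash n m) → m ∸ ∣ S ∣ ≤ length (elements (allowed inside S h))
  allowed-inside-≥ S h = begin
    m ∸ ∣ S ∣                            ≤⟨ ∸-monoʳ-≤ m (colours-size h S) ⟩
    m ∸ ∣ colours h S ∣                  ≡⟨ sym (∣∁p∣≡n∸∣p∣ (colours h S)) ⟩
    ∣ ∁ (colours h S) ∣                  ≡⟨ sym (elements-length (∁ (colours h S))) ⟩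
    length (elements (∁ (colours h S)))  ∎
    where open ≤-Reasoning

  allowed-outside-≥ : ∀ {n} (S : Subset n) (h : Hash n m) → m ≤ length (elements (allowed outside S h))
  allowed-outside-≥ S h = ≤-reflexive (sym (trans (elements-length (⊤ {m})) (∣⊤∣≡n m)))

  collision-bound : ∀ {n} (S : Subset n) →
    length (injectiveHashes S) ≤ m ^ n ×
    m * m ^ n ≤ m * length (injectiveHashes S) + ∣ S ∣ * ∣ S ∣ * m ^ n
  collision-bound []      = ≤-refl , ≤-reflexive (sym (+-identityʳ _))
  collision-bound {suc n} (s ∷ S) with collision-bound S
  ... | N≤M , bound = upper , lower s
    where
    N : ℕ
    N = length (injectiveHashes S)
    heads : Side → Hash n m → List (Fin m)
    heads s h = elements (allowed s S h)
    upper : length (injectiveHashes (s ∷ S)) ≤ m * m ^ n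
    upper = ≤-trans (extensions-length-≤ (heads s) m (injectiveHashes S) (allowed-≤ s S))
                    (*-monoʳ-≤ m N≤M)
    lower : ∀ s → m * (m * m ^ n) ≤ m * length (injectiveHashes (s ∷ S)) + ∣ s ∷ S ∣ * ∣ s ∷ S ∣ * (m * m ^ n)
    lower outside = scale-bound m (m ^ n) m N _ (∣ S ∣ * ∣ S ∣) bound
      (extensions-length-≥ (heads outside) m (injectiveHashes S) (allowed-outside-≥ S))
    lower inside  = scale-bound m (m ^ n) (m ∸ ∣ S ∣) N _ (suc ∣ S ∣ * suc ∣ S ∣)
      (fresh-choice-bound m (m ^ n) N ∣ S ∣ bound N≤M)
      (extensions-length-≥ (heads inside) (m ∸ ∣ S ∣) (injectiveHashes S) (allowed-inside-≥ S))

toVec-ordered : ∀ {A : Set} {R : A → A → Set} {d} (xs : List A) → AllPairs R xs → length xs ≡ d →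
  Σ (Vec A d) λ t → (∀ j j′ → j <ᶠ j′ → R (lookup t j) (lookup t j′)) × (∀ j → lookup t j ∈ xs)
toVec-ordered []       []                 refl = [] , (λ ()) , (λ ())
toVec-ordered {R = R} (x ∷ xs) (x≺xs ∷ ordered) refl with toVec-ordered xs ordered refl
... | t , t-ordered , t⊆xs = x ∷ t , ordered′ , t⊆x∷xs
  where
  ordered′ : ∀ j j′ → j <ᶠ j′ → R (lookup (x ∷ t) j) (lookup (x ∷ t) j′)
  ordered′ zero    (suc j′) _          = All.lookup x≺xs (t⊆xs j′)
  ordered′ (suc j) (suc j′) (s≤s j<j′) = t-ordered j j′ j<j′
  t⊆x∷xs : ∀ j → lookup (x ∷ t) j ∈ x ∷ xs
  t⊆x∷xs zero    = here refl
  t⊆x∷xs (suc j) = there (t⊆xs j)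

increasing-injective : ∀ {m d} (t : Vec (Fin m) d) → (∀ j j′ → j <ᶠ j′ → lookup t j <ᶠ lookup t j′) →
  ∀ {j j′} → lookup t j ≡ lookup t j′ → j ≡ j′
increasing-injective t increasing {j} {j′} tj≡tj′ with Finₚ.<-cmp j j′
... | tri< j<j′ _ _ = ⊥-elim (Finₚ.<-irrefl tj≡tj′ (increasing j j′ j<j′))
... | tri≈ _ j≡j′ _ = j≡j′
... | tri> _ _ j′<j = ⊥-elim (Finₚ.<-irrefl (sym tj≡tj′) (increasing j′ j j′<j))

-- If a subset q of size d has a vertex of each of d distinct colours t_j, these are
-- all of its vertices: every vertex of q has one of the colours t_j.
fits-only : ∀ {n m d} (h : Hash n m) (t : Vec (Fin m) d) (q : Subset n) → ∣ q ∣ ≡ d →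
  (∀ {j j′} → lookup t j ≡ lookup t j′ → j ≡ j′) → Fits h t q →
  ∀ {w} → w ∈ˢ q → ∃ λ j → lookup h w ≡ lookup t j
fits-only {n} {d = d} h t q ∣q∣≡d t-injective fits {w} w∈q
  with Finₚ.any? (λ j → lookup h w Finₚ.≟ lookup t j)
... | yes found  = found
... | no  ¬found = ⊥-elim (n≮n d (begin-strict
  d                    <⟨ n<1+n d ⟩
  suc d                ≡⟨ cong suc (sym (length-tabulate witness)) ⟩
  length (w ∷ tabulate witness) ≤⟨ unique-⊆-size q distinct (w∈q ∷ Allₚ.tabulate⁺ (λ j → proj₁ (proj₂ (fits j)))) ⟩
  ∣ q ∣                ≡⟨ ∣q∣≡d ⟩
  d                    ∎))
  where
  open ≤-Reasoning
  witness : Fin d → Fin n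
  witness j = proj₁ (fits j)
  colour-of-witness : ∀ j → lookup h (witness j) ≡ lookup t j
  colour-of-witness j = proj₂ (proj₂ (fits j))
  w-new : ∀ {v} → v ∈ tabulate witness → w ≢ v
  w-new v∈ refl with ∈-tabulate⁻ v∈
  ... | j , refl = ¬found (j , colour-of-witness j)
  distinct : Unique (w ∷ tabulate witness)
  distinct = All.tabulate w-new
    ∷ Uniqueₚ.tabulate⁺ (λ {j} {j′} wj≡wj′ →
        t-injective (trans (sym (colour-of-witness j)) (trans (cong (lookup h) wj≡wj′) (colour-of-witness j′))))

colour-query : ∀ {n m d} (h : Hash n m) (e : Subset n) → ∣ e ∣ ≡ d → InjectiveOn h e →
  Σ (Vec (Fin m) d) λ t → ValidQuery h t × Fits h t e × (∀ j → lookup t j ∈ˢ colours h e)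
colour-query h e ∣e∣≡d inj
  with toVec-ordered (elements (colours h e)) (elements-increasing (colours h e))
         (trans (elements-length (colours h e)) (trans (colours-size-injective h e inj) ∣e∣≡d))
... | t , t-increasing , t⊆colours = t , (t-increasing , λ j → proj₁ (e-fits j) , proj₂ (proj₂ (e-fits j))) , e-fits , colour-of
  where
  colour-of : ∀ j → lookup t j ∈ˢ colours h e
  colour-of j = elements⁻ (colours h e) (t⊆colours j)
  e-fits : Fits h t e
  e-fits j = colours⁻ h e (colour-of j)

module Queries {n m d : ℕ} (H : Hypergraph n) (uniform : Uniform d H) (h : Hash n m)
  (ans : Answers n m d) (valid : ValidAnswers H h ans) where

  ColouredWithin : Subset n → Subset n → Set
  ColouredWithin q S = ∀ {w} → w ∈ˢ q → lookup h w ∈ˢ colours h S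

  answer-edge : ∀ e → e ∈ H → InjectiveOn h e → ∃ λ q → HatEdge h ans q × ColouredWithin q e
  answer-edge e e∈H inj with colour-query h e (All.lookup uniform e∈H) inj
  ... | t , query , e-fits , t⊆colours with ans t in answer≡
  ...   | nothing = ⊥-elim (proj₁ (valid t query) answer≡ (e , e∈H , e-fits))
  ...   | just q  = q , (t , query , answer≡) , q-within
    where
    q∈H×fits : q ∈ H × Fits h t q
    q∈H×fits = proj₂ (valid t query) q answer≡
    q-within : ColouredWithin q e
    q-within w∈q with fits-only h t q (All.lookup uniform (proj₁ q∈H×fits))
                        (increasing-injective t (proj₁ query)) (proj₂ q∈H×fits) w∈q
    ... | j , hw≡tj = subst (_∈ˢ colours h e) (sym hw≡tj) (t⊆colours j)

  within-mono : ∀ {q S T} → S ⊆ˢ T → ColouredWithin q S → ColouredWithin q T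
  within-mono S⊆T q-within w∈q = colours-mono h S⊆T (q-within w∈q)

  Disjoint : Subset n → Subset n → Set
  Disjoint a b = Empty (a ∩ b)

  coloured-disjoint : ∀ {a S q q′} → InjectiveOn h (a ∪ S) → Disjoint a S →
    ColouredWithin q a → ColouredWithin q′ S → Disjoint q q′
  coloured-disjoint {a} {S} {q} {q′} inj a∩S=∅ q-within q′-within (x , x∈q∩q′)
    with x∈p∩q⁻ q q′ x∈q∩q′
  ... | x∈q , x∈q′ with colours⁻ h a (q-within x∈q) | colours⁻ h S (q′-within x∈q′)
  ...   | u , u∈a , hu≡hx | v , v∈S , hv≡hx
    with inj (p⊆p∪q S u∈a) (q⊆p∪q a S v∈S) (trans hu≡hx (sym hv≡hx))
  ...     | refl = a∩S=∅ (u , x∈p∩q⁺ (u∈a , v∈S))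

  disjoint-⋃ : ∀ {a} (P : List (Subset n)) → All (Disjoint a) P → Disjoint a (⋃ P)
  disjoint-⋃ {a} P a∩P=∅ (x , x∈a∩⋃P) with x∈p∩q⁻ a (⋃ P) x∈a∩⋃P
  ... | x∈a , x∈⋃P with ∈⋃⁻ P x∈⋃P
  ...   | b , b∈P , x∈b = All.lookup a∩P=∅ b∈P (x , x∈p∩q⁺ (x∈a , x∈b))

  transfer-packing : (P : List (Subset n)) → All (_∈ H) P → AllPairs Disjoint P → InjectiveOn h (⋃ P) →
    Σ (List (Subset n)) λ Q → All (HatEdge h ans) Q × AllPairs Disjoint Q × length Q ≡ length P ×
      All (λ q → ColouredWithin q (⋃ P)) Q
  transfer-packing []      []           []             inj = [] , [] , [] , refl , []
  transfer-packing (a ∷ P) (a∈H ∷ P⊆H) (a∩P=∅ ∷ P-disj) inj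
    with transfer-packing P P⊆H P-disj (injectiveOn-⊆ h (q⊆p∪q a (⋃ P)) inj)
       | answer-edge a a∈H (injectiveOn-⊆ h (p⊆p∪q (⋃ P)) inj)
  ... | Q , Q-hat , Q-disj , ∣Q∣≡∣P∣ , Q-within | q , q-hat , q-within =
    q ∷ Q , q-hat ∷ Q-hat ,
    All.map (coloured-disjoint inj (disjoint-⋃ P a∩P=∅) q-within) Q-within ∷ Q-disj ,
    cong suc ∣Q∣≡∣P∣ ,
    within-mono (p⊆p∪q (⋃ P)) q-within ∷ All.map (within-mono (q⊆p∪q a (⋃ P))) Q-within

gamma-large : ∀ d k → 3 * ((d * k) * (d * k)) ≤ gamma d * (k * k)
gamma-large d k = begin
  3 * ((d * k) * (d * k))     ≡⟨ regroup d k ⟩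
  3 * (d * d * (k * k))       ≤⟨ *-monoˡ-≤ (d * d * (k * k)) {3} {100} (s≤s (s≤s (s≤s z≤n))) ⟩
  100 * (d * d * (k * k))     ≡⟨ sym (*-assoc 100 (d * d) (k * k)) ⟩
  gamma d * (k * k)           ∎
  where
  open ≤-Reasoning
  regroup : ∀ d k → 3 * ((d * k) * (d * k)) ≡ 3 * (d * d * (k * k))
  regroup = solve-∀

gamma-positive : ∀ d k → d ≥ 1 → k ≥ 1 → 0 < gamma d * (k * k)
gamma-positive (suc d) (suc k) _ _ = s≤s z≤n

lemma1 : (d n k : ℕ) → d ≥ 2 → k ≥ 1 → (H : Hypergraph n) → Uniform d H →
    HasPacking H k →
    ProbAtLeastTwoThirds n (gamma d * (k * k)) (Good d H k)
lemma1 d n k d≥2 k≥1 H uniform (P₀ , P₀⊆H , P₀-disjoint , k≤∣P₀∣) =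
  injectiveHashes S , injectiveHashes-unique S , All.map (λ {h} → good {h}) (injectiveHashes-injective S) ,
  two-thirds m (m ^ n) _ ∣ S ∣ (d * k) (proj₂ (collision-bound S)) ∣S∣≤dk
    (gamma-large d k) (gamma-positive d k (≤-trans (s≤s z≤n) d≥2) k≥1)
  where
  m : ℕ
  m = gamma d * (k * k)
  open InjectiveHashes m
  P : List (Subset n)
  P = take k P₀
  ∣P∣≡k : length P ≡ k
  ∣P∣≡k = trans (length-take k P₀) (m≤n⇒m⊓n≡m k≤∣P₀∣)
  P⊆H : All (_∈ H) P
  P⊆H = Allₚ.take⁺ k P₀⊆H
  S : Subset n
  S = ⋃ P
  ∣S∣≤dk : ∣ S ∣ ≤ d * k
  ∣S∣≤dk = subst (λ ℓ → ∣ S ∣ ≤ d * ℓ) ∣P∣≡k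
    (∣⋃∣≤ d P (All.map (λ e∈H → ≤-reflexive (All.lookup uniform e∈H)) P⊆H))
  good : ∀ {h} → InjectiveOn h S → Good d H k h
  good {h} inj ans valid
    with Queries.transfer-packing H uniform h ans valid P P⊆H (AllPairsₚ.take⁺ k P₀-disjoint) inj
  ... | Q , Q-hat , Q-disjoint , ∣Q∣≡∣P∣ , _ = Q , Q-hat , Q-disjoint , ≤-reflexive (sym (trans ∣Q∣≡∣P∣ ∣P∣≡k))
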